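{- Let $n$ be an even number and $G$ a Steinhaus graph on vertices $V_1,\ldots,V_n$ whose Steinhaus matrix $M=(a_{i,j})$ is multi-symmetric. Then, viewing entries as integers $0,1$: $\deg(V_1)=\deg(V_n)\equiv a_{1,\frac{n}{2}+1}\pmod 2$; $\deg(V_2)=\deg(V_{n-1})\equiv 2a_{1,\frac{n}{2}+1}\pmod 4$; $\deg(V_3)=\deg(V_{n-2})\equiv 2a_{2,\frac{n}{2}+1}\pmod 4$; $\deg(V_{2i})=\deg(V_{n-2i+1})\equiv 2a_{2,2i+1}+2a_{i,2i+1}\pmod 4$ for all $2\leq i\leq \frac{n}{2}-2$.
   Context: A Steinhaus matrix of size $n\geq1$ is a matrix $M=(a_{i,j})_{1\leq i,j\leq n}$ with entries in $\mathbb{F}_2=\{0,1\}$ such that $a_{i,i}=0$ for all $i$, $a_{i,j}=a_{i-1,j-1}+a_{i-1,j}$ (addition in $\mathbb{F}_2$) for all $2\leq i<j\leq n$, and $a_{i,j}=a_{j,i}$ for all $i,j$. The Steinhaus graph associated with $M$ is the simple graph on vertices $V_1,\ldots,V_n$ with adjacency matrix $M$; $\deg(V_i)=\sum_j a_{i,j}$ as integers. A square matrix $(a_{i,j})$ of size $n$ is doubly-symmetric if $a_{i,j}=a_{j,i}=a_{n-j+1,n-i+1}$ for all $i,j$; it is multi-symmetric if it is doubly-symmetric and $a_{i,j}=a_{i,n-j+i+1}$ for all $1\leq i<j\leq n$. -}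

module Defs where

open import Data.Nat using (ℕ; zero; suc; _+_; _*_; _∸_; _≤_; _<_)
open import Data.Bool using (Bool; true; false; _xor_)
open import Data.List using (List; map; upTo)
open import Data.Nat.ListAction using (sum)
open import Data.Product using (_×_)
open import Relation.Binary.PropositionalEquality using (_≡_)

-- A square matrix over F₂ = Bool, indexed 1-based by natural numbers.
-- Only entries with indices in 1..n are meaningful; others are ignored.
Matrix : Set
Matrix = ℕ → ℕ → Bool

bit : Bool → ℕ
bit false = 0
bit true  = 1

IsSteinhaus : ℕ → Matrix → Set
IsSteinhaus n M =
    (∀ i → 1 ≤ i → i ≤ n → M i i ≡ false)
  × (∀ i j → 2 ≤ i → i < j → j ≤ n → M i j ≡ (M (i ∸ 1) (j ∸ 1) xor M (i ∸ 1) j))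
  × (∀ i j → 1 ≤ i → i ≤ n → 1 ≤ j → j ≤ n → M i j ≡ M j i)

IsDoublySymmetric : ℕ → Matrix → Set
IsDoublySymmetric n M =
  ∀ i j → 1 ≤ i → i ≤ n → 1 ≤ j → j ≤ n →
    (M i j ≡ M j i) × (M i j ≡ M (n ∸ j + 1) (n ∸ i + 1))

IsMultiSymmetric : ℕ → Matrix → Set
IsMultiSymmetric n M =
  IsDoublySymmetric n M
  × (∀ i j → 1 ≤ i → i < j → j ≤ n → M i j ≡ M i (n ∸ j + i + 1))

deg : ℕ → Matrix → ℕ → ℕ
deg n M i = sum (map (λ j → bit (M i (suc j))) (upTo n))

-- By double symmetry the entries of row i left of the diagonal are, reversed, those of
-- row n + 1 − i right of it, so deg(V_i) is the sum of the right-of-diagonal segments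
-- of rows i and n + 1 − i; in particular deg(V_i) = deg(V_{n+1−i}). Multi-symmetry makes
-- each segment a palindrome, whose sum is twice the sum of its first half plus, for odd
-- length, a central entry; reflected, that entry is an a_{x,2x}, which vanishes whenever
-- 2x < n, i.e. in every row but the first. Modulo 4 the degree is thus twice the parity of two half-segment
-- sums, and the Steinhaus rule telescopes each of these modulo 2 to two entries of the
-- row above; the symmetries identify what remains with the entries in the statement.

module Submission where

open import Defs
open import Data.Bool using (Bool; true; false; _xor_)
open import Data.Bool.Properties using (not-involutive; xor-same; xor-assoc; xor-identityʳ)
open import Data.List using (_∷_; []; map; applyUpTo)
open import Data.Nat using (ℕ; zero; suc; _+_; _*_; _∸_; _≤_; _<_; _/_; _%_; z≤n; s≤s; parity)
open import Data.Nat.Properties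
open import Data.Nat.DivMod using (m*n/n≡m; [m+n]%n≡m%n; [m+kn]%n≡m%n)
open import Data.Nat.Divisibility using (_∣_; divides)
open import Data.Nat.ListAction using (sum)
open import Data.Nat.Tactic.RingSolver using (solve; solve-∀)
import Data.Parity.Base as ℙ
import Data.Parity.Properties as ℙ
open import Data.Product using (_×_; _,_; proj₁; proj₂; ∃-syntax; uncurry)
open import Function using (_∘_; id)
open import Relation.Nullary using (contradiction)
open import Relation.Binary.PropositionalEquality

∑ : ℕ → (ℕ → ℕ) → ℕ
∑ zero    f = 0
∑ (suc m) f = f 0 + ∑ m (f ∘ suc)

sum-map-applyUpTo : ∀ (g f : ℕ → ℕ) m → sum (map g (applyUpTo f m)) ≡ ∑ m (g ∘ f)
sum-map-applyUpTo g f zero    = refl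
sum-map-applyUpTo g f (suc m) = cong (g (f 0) +_) (sum-map-applyUpTo g (f ∘ suc) m)

∑-+ : ∀ a b f → ∑ (a + b) f ≡ ∑ a f + ∑ b (λ t → f (a + t))
∑-+ zero    b f = refl
∑-+ (suc a) b f = trans (cong (f 0 +_) (∑-+ a b (f ∘ suc))) (sym (+-assoc (f 0) _ _))

∑-suc : ∀ m f → ∑ (suc m) f ≡ ∑ m f + f m
∑-suc zero    f = +-comm (f 0) 0
∑-suc (suc m) f = trans (cong (f 0 +_) (∑-suc m (f ∘ suc))) (sym (+-assoc (f 0) _ _))

∑-reverse : ∀ m {f g} → (∀ t → t < m → f t ≡ g (m ∸ suc t)) → ∑ m f ≡ ∑ m g
∑-reverse zero    eq = refl
∑-reverse (suc m) {f} {g} eq = begin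
  f 0 + ∑ m (f ∘ suc)  ≡⟨ cong₂ _+_ (eq 0 (s≤s z≤n)) (∑-reverse m (λ t t<m → eq (suc t) (s≤s t<m))) ⟩
  g m + ∑ m g          ≡⟨ +-comm (g m) _ ⟩
  ∑ m g + g m          ≡⟨ ∑-suc m g ⟨
  ∑ (suc m) g          ∎
  where open ≡-Reasoning

IsPalindrome : ℕ → (ℕ → ℕ) → Set
IsPalindrome L f = ∀ t → t < L → f t ≡ f (L ∸ suc t)

h+a∸[1+h+t]≡a∸[1+t] : ∀ h a t → h + a ∸ suc (h + t) ≡ a ∸ suc t
h+a∸[1+h+t]≡a∸[1+t] h a t = trans (cong (h + a ∸_) (sym (+-suc h t))) ([m+n]∸[m+o]≡n∸o h a (suc t))

∑-palindrome-even : ∀ h f → IsPalindrome (h + h) f → ∑ (h + h) f ≡ ∑ h f + ∑ h f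
∑-palindrome-even h f pal = trans (∑-+ h h f) (cong (∑ h f +_) (∑-reverse h second-half))
  where
  second-half : ∀ t → t < h → f (h + t) ≡ f (h ∸ suc t)
  second-half t t<h = trans (pal (h + t) (+-monoʳ-< h t<h)) (cong f (h+a∸[1+h+t]≡a∸[1+t] h h t))

∑-palindrome-odd : ∀ h f → IsPalindrome (h + suc h) f → ∑ (h + suc h) f ≡ ∑ h f + ∑ h f + f h
∑-palindrome-odd h f pal = begin
  ∑ (h + suc h) f                                 ≡⟨ ∑-+ h (suc h) f ⟩
  ∑ h f + (f (h + 0) + ∑ h (λ t → f (h + suc t))) ≡⟨ cong₂ (λ x y → ∑ h f + (f x + y)) (+-identityʳ h) (∑-reverse h second-half) ⟩
  ∑ h f + (f h + ∑ h f)                           ≡⟨ cong (∑ h f +_) (+-comm (f h) _) ⟩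
  ∑ h f + (∑ h f + f h)                           ≡⟨ +-assoc (∑ h f) _ _ ⟨
  ∑ h f + ∑ h f + f h                             ∎
  where
  open ≡-Reasoning
  second-half : ∀ t → t < h → f (h + suc t) ≡ f (h ∸ suc t)
  second-half t t<h = trans (pal (h + suc t) (+-monoʳ-< h (s≤s t<h))) (cong f (h+a∸[1+h+t]≡a∸[1+t] h (suc h) (suc t)))

xor-cancelˡ : ∀ a b → a xor (a xor b) ≡ b
xor-cancelˡ a b = trans (sym (xor-assoc a a b)) (cong (_xor b) (xor-same a))

parity-bit-xor : ∀ a b → parity (bit (a xor b)) ≡ parity (bit a) ℙ.+ parity (bit b)
parity-bit-xor false b     = refl
parity-bit-xor true  false = refl
parity-bit-xor true  true  = refl

parity-∑-telescope : ∀ h (F : ℕ → Bool) {g} → (∀ t → t < h → g t ≡ bit (F t xor F (suc t))) →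
                     parity (∑ h g) ≡ parity (bit (F 0 xor F h))
parity-∑-telescope zero    F eq = cong (parity ∘ bit) (sym (xor-same (F 0)))
parity-∑-telescope (suc h) F {g} eq = begin
  parity (g 0 + ∑ h (g ∘ suc))                                    ≡⟨ ℙ.+-homo-+ (g 0) _ ⟩
  parity (g 0) ℙ.+ parity (∑ h (g ∘ suc))                         ≡⟨ cong₂ ℙ._+_ (cong parity (eq 0 (s≤s z≤n)))
                                                                        (parity-∑-telescope h (F ∘ suc) (λ t t<h → eq (suc t) (s≤s t<h))) ⟩
  parity (bit (F 0 xor F 1)) ℙ.+ parity (bit (F 1 xor F (suc h)))  ≡⟨ parity-bit-xor (F 0 xor F 1) _ ⟨
  parity (bit ((F 0 xor F 1) xor (F 1 xor F (suc h))))             ≡⟨ cong (parity ∘ bit) (telescope (F 0) (F 1) (F (suc h))) ⟩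
  parity (bit (F 0 xor F (suc h)))                                 ∎
  where
  open ≡-Reasoning
  telescope : ∀ a b c → (a xor b) xor (b xor c) ≡ a xor c
  telescope false false c = refl
  telescope false true  c = not-involutive c
  telescope true  false c = refl
  telescope true  true  c = refl

2-periodic⇒parity-cong : ∀ (f : ℕ → ℕ) → (∀ u → f (2 + u) ≡ f u) →
                         ∀ {u v} → parity u ≡ parity v → f u ≡ f v
2-periodic⇒parity-cong f per {0}           {0}           _  = refl
2-periodic⇒parity-cong f per {1}           {1}           _  = refl
2-periodic⇒parity-cong f per {suc (suc u)} {v}           eq = trans (per u) (2-periodic⇒parity-cong f per {u} {v} eq)
2-periodic⇒parity-cong f per {0}           {suc (suc v)} eq = trans (2-periodic⇒parity-cong f per {0} {v} eq) (sym (per v))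
2-periodic⇒parity-cong f per {1}           {suc (suc v)} eq = trans (2-periodic⇒parity-cong f per {1} {v} eq) (sym (per v))

double-%4-parity-cong : ∀ {u v} → parity u ≡ parity v → (u + u) % 4 ≡ (v + v) % 4
double-%4-parity-cong {u} {v} = 2-periodic⇒parity-cong (λ u → (u + u) % 4) period {u} {v}
  where
  period : ∀ u → (2 + u + (2 + u)) % 4 ≡ (u + u) % 4
  period u = trans (cong (_% 4) (shift u)) ([m+n]%n≡m%n (u + u) 4)
    where
    shift : ∀ u → 2 + u + (2 + u) ≡ u + u + 4
    shift = solve-∀

[m+m+n]%2≡n%2 : ∀ m n → (m + m + n) % 2 ≡ n % 2
[m+m+n]%2≡n%2 m n = trans (cong (_% 2) (shift m n)) ([m+kn]%n≡m%n n m 2)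
  where
  shift : ∀ m n → m + m + n ≡ n + m * 2
  shift = solve-∀

double-bit-xor-%4 : ∀ a b → (2 * bit a + 2 * bit b) % 4 ≡ (2 * bit (a xor b)) % 4
double-bit-xor-%4 false b     = refl
double-bit-xor-%4 true  false = refl
double-bit-xor-%4 true  true  = refl

n≡m+o⇒m≤n : ∀ {n m o} → n ≡ m + o → m ≤ n
n≡m+o⇒m≤n {m = m} {o} e = subst (m ≤_) (sym e) (m≤m+n m o)

even-≥4 : ∀ {n} m → n ≡ suc m * 2 → 4 ≤ n → ∃[ m′ ] n ≡ suc (suc m′) * 2
even-≥4 zero    e 4≤n = contradiction (subst (4 ≤_) e 4≤n) λ { (s≤s (s≤s ())) }
even-≥4 (suc m) e _   = m , e

n≡q*2⇒n/2≡q : ∀ {n} q → n ≡ q * 2 → n / 2 ≡ q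
n≡q*2⇒n/2≡q q e = trans (cong (_/ 2) e) (m*n/n≡m q 2)

n≡q*2⇒n/2+1≡1+q : ∀ {n} q → n ≡ q * 2 → n / 2 + 1 ≡ 1 + q
n≡q*2⇒n/2+1≡1+q q e = trans (cong (_+ 1) (n≡q*2⇒n/2≡q q e)) (+-comm q 1)

-- `row M i t` is the entry t + 1 places right of the diagonal in row i, so that
-- `rowSum M i (n ∸ i)` is the part of deg(V_i) lying right of the diagonal.

row : Matrix → ℕ → ℕ → ℕ
row M i t = bit (M i (i + suc t))

rowSum : Matrix → ℕ → ℕ → ℕ
rowSum M i L = ∑ L (row M i)

-- Entries above the diagonal are addressed as (i, i + p) with n ≡ i + p + c, so c is the
-- number of columns to their right.

module DoublySymmetric {n : ℕ} {M : Matrix} (ds : IsDoublySymmetric n M) where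

  entry-reflect : ∀ {i p c} → n ≡ i + p + c → 1 ≤ i → M i (i + p) ≡ M (suc c) (suc c + p)
  entry-reflect {i} {p} {c} e 1≤i =
    trans (proj₂ (ds i (i + p) 1≤i i≤n (≤-trans 1≤i (m≤m+n i p)) (n≡m+o⇒m≤n e))) (cong₂ M row-index column-index)
    where
    e′ : n ≡ i + (p + c)
    e′ = trans e (+-assoc i p c)
    i≤n : i ≤ n
    i≤n = n≡m+o⇒m≤n e′
    row-index : n ∸ (i + p) + 1 ≡ suc c
    row-index = trans (cong (λ x → x ∸ (i + p) + 1) e) (trans (cong (_+ 1) (m+n∸m≡n (i + p) c)) (+-comm c 1))
    column-index : n ∸ i + 1 ≡ suc c + p
    column-index = trans (cong (λ x → x ∸ i + 1) e′) (trans (cong (_+ 1) (m+n∸m≡n i (p + c))) (solve (p ∷ c ∷ [])))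

  column-entry : ∀ {k r t} → n ≡ suc k + r → t < k → M (suc k) (suc t) ≡ M (suc r) (suc r + suc (k ∸ suc t))
  column-entry {r = r} {t} e t<k with m≤n⇒∃[o]m+o≡n t<k
  ... | d , refl = begin
    M (suc (suc t + d)) (suc t)        ≡⟨ proj₁ (ds _ (suc t) (s≤s z≤n) (n≡m+o⇒m≤n e) (s≤s z≤n) t<n) ⟩
    M (suc t) (suc (suc t + d))        ≡⟨ cong (M (suc t)) (+-suc (suc t) d) ⟨
    M (suc t) (suc t + suc d)          ≡⟨ entry-reflect e′ (s≤s z≤n) ⟩
    M (suc r) (suc r + suc d)          ≡⟨ cong (λ x → M (suc r) (suc r + suc x)) (m+n∸m≡n (suc t) d) ⟨
    M (suc r) (suc r + suc (suc t + d ∸ suc t)) ∎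
    where
    open ≡-Reasoning
    e′ : n ≡ suc t + suc d + r
    e′ = trans e (solve (t ∷ d ∷ r ∷ []))
    t<n : suc t ≤ n
    t<n = ≤-trans (m≤m+n (suc t) (suc d)) (n≡m+o⇒m≤n e′)

  module ZeroDiagonal (zero-diagonal : ∀ i → 1 ≤ i → i ≤ n → M i i ≡ false) where

    deg≡rowSums : ∀ {k r} → n ≡ suc k + r → deg n M (suc k) ≡ rowSum M (suc r) k + rowSum M (suc k) r
    deg≡rowSums {k} {r} e = begin
      deg n M (suc k)                                            ≡⟨ sum-map-applyUpTo G id n ⟩
      ∑ n G                                                      ≡⟨ cong (λ m → ∑ m G) (trans e (sym (+-suc k r))) ⟩
      ∑ (k + suc r) G                                            ≡⟨ ∑-+ k (suc r) G ⟩
      ∑ k G + (G (k + 0) + rowSum M (suc k) r)                   ≡⟨ cong₂ (λ x y → x + (y + rowSum M (suc k) r)) left-of-diagonal on-diagonal ⟩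
      rowSum M (suc r) k + rowSum M (suc k) r                    ∎
      where
      open ≡-Reasoning
      G : ℕ → ℕ
      G j = bit (M (suc k) (suc j))
      left-of-diagonal : ∑ k G ≡ rowSum M (suc r) k
      left-of-diagonal = ∑-reverse k (λ t t<k → cong bit (column-entry e t<k))
      on-diagonal : G (k + 0) ≡ 0
      on-diagonal = trans (cong (λ x → bit (M (suc k) (suc x))) (+-identityʳ k))
                          (cong bit (zero-diagonal (suc k) (s≤s z≤n) (n≡m+o⇒m≤n e)))

    deg-mirror : ∀ {k r} → n ≡ suc k + r → deg n M (suc k) ≡ deg n M (suc r)
    deg-mirror {k} {r} e = begin
      deg n M (suc k)                          ≡⟨ deg≡rowSums e ⟩
      rowSum M (suc r) k + rowSum M (suc k) r  ≡⟨ +-comm (rowSum M (suc r) k) _ ⟩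
      rowSum M (suc k) r + rowSum M (suc r) k  ≡⟨ deg≡rowSums {r} {k} (trans e (solve (k ∷ r ∷ []))) ⟨
      deg n M (suc r)                          ∎
      where open ≡-Reasoning

    deg-mirror-∸ : ∀ {v} → 1 ≤ v → v ≤ n → deg n M v ≡ deg n M (n ∸ v + 1)
    deg-mirror-∸ {suc k} _ v≤n =
      trans (deg-mirror (sym (m+[n∸m]≡n v≤n))) (cong (deg n M) (+-comm 1 (n ∸ suc k)))

module MultiSymmetric {n : ℕ} {M : Matrix} (ms : IsMultiSymmetric n M) where

  open DoublySymmetric (proj₁ ms) public

  entry-palindrome : ∀ {i p c} → n ≡ i + p + c → 1 ≤ i → 1 ≤ p → M i (i + p) ≡ M i (i + suc c)
  entry-palindrome {i} {p} {c} e 1≤i 1≤p =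
    trans (proj₂ ms i (i + p) 1≤i (m<m+n i 1≤p) (n≡m+o⇒m≤n e)) (cong (M i) index)
    where
    index : n ∸ (i + p) + i + 1 ≡ i + suc c
    index = trans (cong (λ x → x ∸ (i + p) + i + 1) e)
                  (trans (cong (λ x → x + i + 1) (m+n∸m≡n (i + p) c)) (solve (i ∷ c ∷ [])))

  entry-transpose : ∀ {i p c} → n ≡ i + p + c → 1 ≤ i → 1 ≤ p → M i (i + p) ≡ M p (p + i)
  entry-transpose {suc i} {suc p} {c} e (s≤s z≤n) (s≤s z≤n) = begin
    M (suc i) (suc i + suc p)  ≡⟨ entry-palindrome e (s≤s z≤n) (s≤s z≤n) ⟩
    M (suc i) (suc i + suc c)  ≡⟨ entry-reflect {suc i} {suc c} {p} (trans e (solve (i ∷ p ∷ c ∷ []))) (s≤s z≤n) ⟩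
    M (suc p) (suc p + suc c)  ≡⟨ entry-palindrome {suc p} {suc c} {i} (trans e (solve (i ∷ p ∷ c ∷ [])))
                                                    (s≤s z≤n) (s≤s z≤n) ⟩
    M (suc p) (suc p + suc i)  ∎
    where open ≡-Reasoning

  row-palindrome : ∀ {i L} → 1 ≤ i → n ≡ i + L → IsPalindrome L (row M i)
  row-palindrome {i} {L} 1≤i e t t<L = cong bit (entry-palindrome (trans e split) 1≤i (s≤s z≤n))
    where
    split : i + L ≡ i + suc t + (L ∸ suc t)
    split = trans (cong (i +_) (sym (m+[n∸m]≡n t<L))) (sym (+-assoc i (suc t) _))

  rowSum-even : ∀ {i} h → 1 ≤ i → n ≡ i + (h + h) → rowSum M i (h + h) ≡ rowSum M i h + rowSum M i h
  rowSum-even h 1≤i e = ∑-palindrome-even h _ (row-palindrome 1≤i e)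

  rowSum-odd : ∀ {i} h → 1 ≤ i → n ≡ i + (h + suc h) →
               rowSum M i (h + suc h) ≡ rowSum M i h + rowSum M i h + row M i h
  rowSum-odd h 1≤i e = ∑-palindrome-odd h _ (row-palindrome 1≤i e)

module Steinhaus {n : ℕ} {M : Matrix} (st : IsSteinhaus n M) where

  entry-step : ∀ {i p} → 1 ≤ i → 1 ≤ p → suc i + p ≤ n → M (suc i) (suc i + p) ≡ M i (i + p) xor M i (i + suc p)
  entry-step {i} {p} 1≤i 1≤p le =
    trans (proj₁ (proj₂ st) (suc i) (suc i + p) (s≤s 1≤i) (m<m+n (suc i) 1≤p) le)
          (cong (λ j → M i (i + p) xor M i j) (sym (+-suc i p)))

  rowSum-parity : ∀ {i} h → 1 ≤ i → suc i + h ≤ n →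
                  parity (rowSum M (suc i) h) ≡ parity (bit (M i (i + 1) xor M i (i + suc h)))
  rowSum-parity {i} h 1≤i le = parity-∑-telescope h (λ t → M i (i + suc t))
    (λ t t<h → cong bit (entry-step 1≤i (s≤s z≤n) (≤-trans (+-monoʳ-≤ (suc i) t<h) le)))

module MultiSymmetricSteinhaus {n : ℕ} {M : Matrix} (st : IsSteinhaus n M) (ms : IsMultiSymmetric n M) where

  open MultiSymmetric ms
  open Steinhaus st
  open ZeroDiagonal (proj₁ st)

  -- The Steinhaus rule and the transpose symmetry express a_{x+1,2x+1} in two ways.
  entry-double≡false : ∀ {x c} → n ≡ x + x + suc c → 1 ≤ x → M x (x + x) ≡ false
  entry-double≡false {x} {c} e 1≤x = absorbed (M x (x + x)) (M x (x + suc x)) (begin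
    M x (x + suc x)                     ≡⟨ entry-transpose {suc x} {x} {c} e′ (s≤s z≤n) 1≤x ⟨
    M (suc x) (suc x + x)               ≡⟨ entry-step 1≤x 1≤x (n≡m+o⇒m≤n e′) ⟩
    M x (x + x) xor M x (x + suc x)     ∎)
    where
    open ≡-Reasoning
    e′ : n ≡ suc x + x + c
    e′ = trans e (solve (x ∷ c ∷ []))
    absorbed : ∀ a b → b ≡ a xor b → a ≡ false
    absorbed false b _  = refl
    absorbed true false ()
    absorbed true true  ()

  row-middle≡0 : ∀ {i h} → 2 ≤ i → n ≡ i + (h + suc h) → row M i h ≡ 0
  row-middle≡0 {suc (suc i)} {h} (s≤s (s≤s z≤n)) e = cong bit (begin
    M (2 + i) (2 + i + suc h)    ≡⟨ entry-reflect {2 + i} {suc h} {h} (trans e (solve (i ∷ h ∷ []))) (s≤s z≤n) ⟩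
    M (suc h) (suc h + suc h)    ≡⟨ entry-double≡false {suc h} {i} (trans e (solve (i ∷ h ∷ []))) (s≤s z≤n) ⟩
    false                        ∎)
    where open ≡-Reasoning

  deg-even-vertex-%4 : ∀ j h → 1 ≤ h → n ≡ suc (j + suc j) + (h + h) →
    let k = j + suc j ; r = h + h in
    deg n M (suc k) % 4 ≡ (2 * bit ((M k (k + 1) xor M k (k + suc h)) xor (M r (r + 1) xor M r (r + suc j)))) % 4
  deg-even-vertex-%4 j h 1≤h e = begin
    deg n M (suc k) % 4                                  ≡⟨ cong (_% 4) (deg≡rowSums e) ⟩
    (rowSum M (suc r) k + rowSum M (suc k) r) % 4        ≡⟨ cong (_% 4) (cong₂ _+_ odd-row even-row) ⟩
    (b + b + 0 + (a + a)) % 4                            ≡⟨ cong (_% 4) (regroup a b) ⟩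
    ((a + b) + (a + b)) % 4                              ≡⟨ double-%4-parity-cong {a + b} {bit X} parity-a+b ⟩
    (bit X + bit X) % 4                                  ≡⟨ cong (λ y → (bit X + y) % 4) (+-identityʳ (bit X)) ⟨
    (2 * bit X) % 4                                      ∎
    where
    open ≡-Reasoning
    k = j + suc j
    r = h + h
    A = M k (k + 1) xor M k (k + suc h)
    B = M r (r + 1) xor M r (r + suc j)
    X = A xor B
    a = rowSum M (suc k) h
    b = rowSum M (suc r) j
    1≤k : 1 ≤ k
    1≤k = ≤-trans (s≤s z≤n) (m≤n+m (suc j) j)
    1≤r : 1 ≤ r
    1≤r = ≤-trans 1≤h (m≤m+n h h)
    e′ : n ≡ suc (h + h) + (j + suc j)
    e′ = trans e (solve (j ∷ h ∷ []))
    e″ : n ≡ suc r + j + suc j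
    e″ = trans e′ (sym (+-assoc (suc r) j (suc j)))
    odd-row : rowSum M (suc r) k ≡ b + b + 0
    odd-row = trans (rowSum-odd j (s≤s z≤n) e′) (cong (b + b +_) (row-middle≡0 (s≤s 1≤r) e′))
    even-row : rowSum M (suc k) r ≡ a + a
    even-row = rowSum-even h (s≤s z≤n) e
    regroup : ∀ a b → b + b + 0 + (a + a) ≡ (a + b) + (a + b)
    regroup = solve-∀
    parity-a+b : parity (a + b) ≡ parity (bit X)
    parity-a+b = begin
      parity (a + b)                          ≡⟨ ℙ.+-homo-+ a b ⟩
      parity a ℙ.+ parity b                   ≡⟨ cong₂ ℙ._+_ (rowSum-parity h 1≤k (n≡m+o⇒m≤n (trans e (sym (+-assoc (suc k) h h)))))
                                                               (rowSum-parity j 1≤r (n≡m+o⇒m≤n e″)) ⟩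
      parity (bit A) ℙ.+ parity (bit B)       ≡⟨ parity-bit-xor A B ⟨
      parity (bit X)                          ∎

  first-vertex : ∀ m → n ≡ suc m * 2 →
    (deg n M 1 ≡ deg n M n) × (deg n M 1 % 2 ≡ bit (M 1 (n / 2 + 1)) % 2)
  first-vertex m e = trans (deg-mirror {0} {suc (m * 2)} e) (cong (deg n M) (sym e)) , (begin
    deg n M 1 % 2                                     ≡⟨ cong (_% 2) (deg≡rowSums e′) ⟩
    rowSum M 1 (m + suc m) % 2                        ≡⟨ cong (_% 2) (rowSum-odd m (s≤s z≤n) e′) ⟩
    (rowSum M 1 m + rowSum M 1 m + row M 1 m) % 2     ≡⟨ [m+m+n]%2≡n%2 (rowSum M 1 m) (row M 1 m) ⟩
    bit (M 1 (1 + suc m)) % 2                         ≡⟨ cong (λ j → bit (M 1 j) % 2) (n≡q*2⇒n/2+1≡1+q (suc m) e) ⟨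
    bit (M 1 (n / 2 + 1)) % 2                         ∎)
    where
    open ≡-Reasoning
    e′ : n ≡ 1 + (m + suc m)
    e′ = trans e (solve (m ∷ []))

  second-vertex : ∀ m → n ≡ suc (suc m) * 2 →
    (deg n M 2 ≡ deg n M (n ∸ 1)) × (deg n M 2 % 4 ≡ (2 * bit (M 1 (n / 2 + 1))) % 4)
  second-vertex m e = trans (deg-mirror {1} {suc m * 2} e) (cong (λ x → deg n M (x ∸ 1)) (sym e)) ,
    trans (deg-even-vertex-%4 0 (suc m) (s≤s z≤n) (trans e (solve (m ∷ [])))) (cong (λ x → (2 * bit x) % 4) (begin
      (M 1 2 xor M 1 (3 + m)) xor (M r (r + 1) xor M r (r + 1))  ≡⟨ cong₂ (λ x y → (x xor M 1 (3 + m)) xor y) M₁₂≡false (xor-same (M r (r + 1))) ⟩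
      M 1 (3 + m) xor false                                      ≡⟨ xor-identityʳ (M 1 (3 + m)) ⟩
      M 1 (3 + m)                                                ≡⟨ cong (M 1) (n≡q*2⇒n/2+1≡1+q (suc (suc m)) e) ⟨
      M 1 (n / 2 + 1)                                            ∎))
    where
    open ≡-Reasoning
    r = suc m + suc m
    M₁₂≡false : M 1 2 ≡ false
    M₁₂≡false = entry-double≡false {1} {suc (m * 2)} (trans e (solve (m ∷ []))) (s≤s z≤n)

  third-vertex : ∀ m → n ≡ suc (suc m) * 2 →
    (deg n M 3 ≡ deg n M (n ∸ 2)) × (deg n M 3 % 4 ≡ (2 * bit (M 2 (n / 2 + 1))) % 4)
  third-vertex m e = trans (deg-mirror {2} {suc (m * 2)} e) (cong (λ x → deg n M (x ∸ 2)) (sym e)) , (begin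
    deg n M 3 % 4                                ≡⟨ cong (_% 4) (deg-mirror {2} {m + suc m} (trans e (solve (m ∷ [])))) ⟩
    deg n M (suc k) % 4                          ≡⟨ deg-even-vertex-%4 m 1 (s≤s z≤n) (trans e (solve (m ∷ []))) ⟩
    (2 * bit ((M k (k + 1) xor M k (k + 2)) xor (M 2 3 xor M 2 (3 + m)))) % 4
                                                 ≡⟨ cong (λ x → (2 * bit (x xor (M 2 3 xor M 2 (3 + m)))) % 4) M₂₃≡ ⟨
    (2 * bit (M 2 3 xor (M 2 3 xor M 2 (3 + m)))) % 4
                                                 ≡⟨ cong (λ x → (2 * bit x) % 4) (xor-cancelˡ (M 2 3) (M 2 (3 + m))) ⟩
    (2 * bit (M 2 (3 + m))) % 4                  ≡⟨ cong (λ x → (2 * bit (M 2 x)) % 4) (n≡q*2⇒n/2+1≡1+q (suc (suc m)) e) ⟨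
    (2 * bit (M 2 (n / 2 + 1))) % 4              ∎)
    where
    open ≡-Reasoning
    k = m + suc m
    e′ : n ≡ suc (m + suc m) + 1 + 1
    e′ = trans e (solve (m ∷ []))
    M₂₃≡ : M 2 3 ≡ M k (k + 1) xor M k (k + 2)
    M₂₃≡ = begin
      M 2 3                          ≡⟨ entry-reflect {suc k} {1} {1} e′ (s≤s z≤n) ⟨
      M (suc k) (suc k + 1)          ≡⟨ entry-step (≤-trans (s≤s z≤n) (m≤n+m (suc m) m)) (s≤s z≤n) (n≡m+o⇒m≤n e′) ⟩
      M k (k + 1) xor M k (k + 2)    ∎

  even-vertex : ∀ m i → n ≡ suc m * 2 → 2 ≤ i → i ≤ m →
    (deg n M (2 * i) ≡ deg n M (n ∸ 2 * i + 1))
    × (deg n M (2 * i) % 4 ≡ (2 * bit (M 2 (2 * i + 1)) + 2 * bit (M i (2 * i + 1))) % 4)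
  even-vertex m i@(suc (suc j)) e (s≤s (s≤s z≤n)) i≤m with m≤n⇒∃[o]m+o≡n i≤m
  ... | d , refl = deg-mirror-∸ (s≤s z≤n) (n≡m+o⇒m≤n n≡2i+r) , (begin
    deg n M (2 * i) % 4                                        ≡⟨ cong (λ v → deg n M v % 4) 2i≡1+k ⟩
    deg n M (suc k) % 4                                        ≡⟨ deg-even-vertex-%4 (suc j) (suc d) (s≤s z≤n) n≡1+k+r ⟩
    (2 * bit ((a xor M k (k + suc h)) xor (M r (r + 1) xor M r (r + i)))) % 4
                                                               ≡⟨ cong (λ x → (2 * bit x) % 4) simplify ⟩
    (2 * bit (M 2 (2 * i + 1) xor M i (2 * i + 1))) % 4        ≡⟨ double-bit-xor-%4 (M 2 (2 * i + 1)) _ ⟨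
    (2 * bit (M 2 (2 * i + 1)) + 2 * bit (M i (2 * i + 1))) % 4 ∎)
    where
    open ≡-Reasoning
    k = suc j + suc (suc j)
    h = suc d
    r = h + h
    a = M k (k + 1)
    1≤k : 1 ≤ k
    1≤k = s≤s z≤n
    1≤r : 1 ≤ r
    1≤r = s≤s z≤n
    2i≡1+k : 2 * suc (suc j) ≡ suc (suc j + suc (suc j))
    2i≡1+k = solve (j ∷ [])
    n≡2i+r : n ≡ 2 * suc (suc j) + (suc d + suc d)
    n≡2i+r = trans e (solve (j ∷ d ∷ []))
    n≡1+k+r : n ≡ suc (suc j + suc (suc j)) + (suc d + suc d)
    n≡1+k+r = trans e (solve (j ∷ d ∷ []))
    far-entry : M k (k + suc h) ≡ false
    far-entry = trans (entry-reflect {k} {suc h} {h} n≡k+[1+h]+h 1≤k)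
                      (entry-double≡false {suc h} {j + suc j} n≡[1+h]+[1+h]+[1+k-2] (s≤s z≤n))
      where
      n≡k+[1+h]+h : n ≡ suc j + suc (suc j) + suc (suc d) + suc d
      n≡k+[1+h]+h = trans e (solve (j ∷ d ∷ []))
      n≡[1+h]+[1+h]+[1+k-2] : n ≡ suc (suc d) + suc (suc d) + suc (j + suc j)
      n≡[1+h]+[1+h]+[1+k-2] = trans e (solve (j ∷ d ∷ []))
    near-entry : M r (r + 1) ≡ a xor M 2 (2 * i + 1)
    near-entry = begin
      M r (r + 1)              ≡⟨ entry-reflect {r} {1} {k} n≡r+1+k 1≤r ⟩
      M (suc k) (suc k + 1)    ≡⟨ entry-step 1≤k (s≤s z≤n) (n≡m+o⇒m≤n n≡1+k+1+[r-1]) ⟩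
      a xor M k (k + 2)        ≡⟨ cong (a xor_) (entry-transpose {k} {2} {d + suc d} n≡k+2+[r-1] 1≤k (s≤s z≤n)) ⟩
      a xor M 2 (2 + k)        ≡⟨ cong (λ x → a xor M 2 x) 2+k≡2i+1 ⟩
      a xor M 2 (2 * i + 1)    ∎
      where
      n≡r+1+k : n ≡ suc d + suc d + 1 + (suc j + suc (suc j))
      n≡r+1+k = trans e (solve (j ∷ d ∷ []))
      n≡1+k+1+[r-1] : n ≡ suc (suc j + suc (suc j)) + 1 + (d + suc d)
      n≡1+k+1+[r-1] = trans e (solve (j ∷ d ∷ []))
      n≡k+2+[r-1] : n ≡ suc j + suc (suc j) + 2 + (d + suc d)
      n≡k+2+[r-1] = trans e (solve (j ∷ d ∷ []))
      2+k≡2i+1 : 2 + (suc j + suc (suc j)) ≡ 2 * suc (suc j) + 1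
      2+k≡2i+1 = solve (j ∷ [])
    central-entry : M r (r + i) ≡ M i (2 * i + 1)
    central-entry = begin
      M r (r + i)              ≡⟨ entry-reflect {r} {i} {i} n≡r+i+i 1≤r ⟩
      M (suc i) (suc i + i)    ≡⟨ entry-transpose {suc i} {i} {d + suc d} n≡1+i+i+[r-1] (s≤s z≤n) (s≤s z≤n) ⟩
      M i (i + suc i)          ≡⟨ cong (M i) i+1+i≡2i+1 ⟩
      M i (2 * i + 1)          ∎
      where
      n≡r+i+i : n ≡ suc d + suc d + suc (suc j) + suc (suc j)
      n≡r+i+i = trans e (solve (j ∷ d ∷ []))
      n≡1+i+i+[r-1] : n ≡ suc (suc (suc j)) + suc (suc j) + (d + suc d)
      n≡1+i+i+[r-1] = trans e (solve (j ∷ d ∷ []))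
      i+1+i≡2i+1 : suc (suc j) + suc (suc (suc j)) ≡ 2 * suc (suc j) + 1
      i+1+i≡2i+1 = solve (j ∷ [])
    simplify : (a xor M k (k + suc h)) xor (M r (r + 1) xor M r (r + i)) ≡ M 2 (2 * i + 1) xor M i (2 * i + 1)
    simplify = begin
      (a xor M k (k + suc h)) xor (M r (r + 1) xor M r (r + i))       ≡⟨ cong₂ (λ x y → (a xor x) xor (y xor M r (r + i))) far-entry near-entry ⟩
      (a xor false) xor ((a xor M 2 (2 * i + 1)) xor M r (r + i))      ≡⟨ cong₂ _xor_ (xor-identityʳ a) (xor-assoc a (M 2 (2 * i + 1)) _) ⟩
      a xor (a xor (M 2 (2 * i + 1) xor M r (r + i)))                  ≡⟨ xor-cancelˡ a _ ⟩
      M 2 (2 * i + 1) xor M r (r + i)                                  ≡⟨ cong (M 2 (2 * i + 1) xor_) central-entry ⟩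
      M 2 (2 * i + 1) xor M i (2 * i + 1)                              ∎

proposition7 : (n : ℕ) → 2 ∣ n → 1 ≤ n → (M : Matrix) →
    IsSteinhaus n M → IsMultiSymmetric n M →
      ((deg n M 1 ≡ deg n M n) × (deg n M 1 % 2 ≡ bit (M 1 (n / 2 + 1)) % 2))
      × (4 ≤ n → (deg n M 2 ≡ deg n M (n ∸ 1))
                 × (deg n M 2 % 4 ≡ (2 * bit (M 1 (n / 2 + 1))) % 4))
      × (4 ≤ n → (deg n M 3 ≡ deg n M (n ∸ 2))
                 × (deg n M 3 % 4 ≡ (2 * bit (M 2 (n / 2 + 1))) % 4))
      × (∀ i → 2 ≤ i → i ≤ n / 2 ∸ 2 →
           (deg n M (2 * i) ≡ deg n M (n ∸ 2 * i + 1))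
           × (deg n M (2 * i) % 4
               ≡ (2 * bit (M 2 (2 * i + 1)) + 2 * bit (M i (2 * i + 1))) % 4))
proposition7 n (divides zero    n≡0)      1≤n M st ms = contradiction (subst (1 ≤_) n≡0 1≤n) λ ()
proposition7 n (divides (suc m) n≡[1+m]*2) _   M st ms =
    first-vertex m n≡[1+m]*2
  , (λ 4≤n → uncurry second-vertex (even-≥4 m n≡[1+m]*2 4≤n))
  , (λ 4≤n → uncurry third-vertex (even-≥4 m n≡[1+m]*2 4≤n))
  , λ i 2≤i i≤n/2∸2 → even-vertex m i n≡[1+m]*2 2≤i (≤-trans (subst (λ x → i ≤ x ∸ 2) n/2≡1+m i≤n/2∸2) (m∸n≤m m 1))
  where
  open MultiSymmetricSteinhaus st ms
  n/2≡1+m : n / 2 ≡ suc m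
  n/2≡1+m = n≡q*2⇒n/2≡q (suc m) n≡[1+m]*2
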